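{- Let $V$ be a $\mathbb Q$-vector space with a right action of $\mathrm{GL}_2^+(\mathbb Q)$. Let $H$ be a subgroup of $\mathrm{GL}_2^+(\mathbb Q)$ and $\mathcal D(H)$ a system of representatives of $H\backslash\mathcal P(\mathbb Q)$. Let $c$ be a $1$-cocycle of $H$ with values in $V$ which vanishes on the stabilisers (in $H$) of all elements of $\mathcal D(H)$. Then there exists $\Psi\in\mathrm{Hom}_H(\Xi_0,V)$ such that $\Psi([Z,\gamma^{ -1}Z])=c(\gamma)$ for all $\gamma\in H$ and all $Z\in\mathcal D(H)$. When $H$ acts transitively on $\mathcal P(\mathbb Q)$, $\Psi$ is unique.
   Context: $\mathcal P(\mathbb Q)$ is the set of formal symbols $\pi_r(s)$ for $r\ne s\in\mathbb P^1(\mathbb Q)$, with left action $\gamma\pi_r(s)=\pi_{\gamma r}(\gamma s)$ of $\mathrm{GL}_2(\mathbb Q)$ (Möbius transformations). $\Xi$ is the free abelian group on $\mathcal P(\mathbb Q)$ and $\Xi_0$ its subgroup of degree-zero elements; $[c_1,c_2]=\{c_2\}-\{c_1\}$. $\mathrm{Hom}_H(\Xi_0,V)$ is the set of group homomorphisms $\Psi:\Xi_0\to V$ with $\Psi(\gamma\delta)=\Psi(\delta)|\gamma^{ -1}$ for $\gamma\in H$. A $1$-cocycle is a map $c:H\to V$ with $c(\gamma_1\gamma_2)=c(\gamma_1)|\gamma_2+c(\gamma_2)$. -}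

module Defs where

open import Level using (Level; _⊔_) renaming (suc to lsuc)
open import Data.Bool using (if_then_else_)
open import Data.Rational using (ℚ; 0ℚ; 1ℚ; _+_; _*_; _-_; -_; _÷_; _<_; ≢-nonZero)
open import Data.Rational.Properties using (_≟_; +-*-commutativeRing)
open import Data.Integer as ℤ using (ℤ)
open import Data.Product using (_×_; _,_; Σ; ∃; ∃-syntax)
open import Data.List using (List; []; _∷_; map; foldr; _++_)
open import Data.List.Relation.Unary.All using (All)
open import Relation.Nullary using (¬_; yes; no; does)
open import Relation.Binary.PropositionalEquality using (_≡_; _≢_)
open import Algebra.Module.Bundles using (Module)

-- ℚ as a commutative ring (a field); ℚ-vector spaces are ℚ-modules

ℚ-ring = +-*-commutativeRing

-- The projective line ℙ¹(ℚ): ∞ = (1:0), fin x = (x:1)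

data ℙ¹ : Set where
  ∞   : ℙ¹
  fin : ℚ → ℙ¹

record M2 : Set where
  constructor mat
  field a b c d : ℚ

det : M2 → ℚ
det (mat a b c d) = a * d - b * c

1M : M2
1M = mat 1ℚ 0ℚ 0ℚ 1ℚ

_*M_ : M2 → M2 → M2
mat a b c d *M mat a' b' c' d' =
  mat (a * a' + b * c') (a * b' + b * d') (c * a' + d * c') (c * b' + d * d')

-- inverse matrix (junk value g when det g = 0; only used on invertible g)
inv : M2 → M2
inv g with det g ≟ 0ℚ
... | yes _ = g
... | no ne = let instance _ = ≢-nonZero ne in
              mat (M2.d g ÷ det g) ((- M2.b g) ÷ det g)
                  ((- M2.c g) ÷ det g) (M2.a g ÷ det g)

GL2⁺ : M2 → Set
GL2⁺ g = 0ℚ < det g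

-- Möbius action on ℙ¹(ℚ):  (a b ; c d)·(x:y) = (ax+by : cx+dy)
mob : M2 → ℙ¹ → ℙ¹
mob (mat a b c d) ∞ with c ≟ 0ℚ
... | yes _ = ∞
... | no ne = let instance _ = ≢-nonZero ne in fin (a ÷ c)
mob (mat a b c d) (fin x) with c * x + d ≟ 0ℚ
... | yes _ = ∞
... | no ne = let instance _ = ≢-nonZero ne in fin ((a * x + b) ÷ (c * x + d))

-- Symbols π_r(s) : pairs (r , s); a pair is a genuine symbol of 𝒫(ℚ) iff r ≢ s

Sym : Set
Sym = ℙ¹ × ℙ¹

IsSym : Sym → Set
IsSym (r , s) = r ≢ s

_•_ : M2 → Sym → Sym
γ • (r , s) = mob γ r , mob γ s

-- Ξ : formal ℤ-linear combinations of symbols, as lists of (coefficient, symbol),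
-- considered up to having the same coefficient at every symbol.

FS : Set
FS = List (ℤ × Sym)

_≟ℙ_ : (x y : ℙ¹) → Relation.Nullary.Dec (x ≡ y)
∞ ≟ℙ ∞ = yes _≡_.refl
∞ ≟ℙ fin _ = no (λ ())
fin _ ≟ℙ ∞ = no (λ ())
fin x ≟ℙ fin y with x ≟ y
... | yes _≡_.refl = yes _≡_.refl
... | no ne = no (λ { _≡_.refl → ne _≡_.refl })

_≟S_ : (P Q : Sym) → Relation.Nullary.Dec (P ≡ Q)
(r , s) ≟S (r' , s') with r ≟ℙ r' | s ≟ℙ s'
... | yes _≡_.refl | yes _≡_.refl = yes _≡_.refl
... | no ne | _ = no (λ { _≡_.refl → ne _≡_.refl })
... | yes _ | no ne = no (λ { _≡_.refl → ne _≡_.refl })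

coeff : FS → Sym → ℤ
coeff [] P = ℤ.0ℤ
coeff ((n , Q) ∷ ξ) P = if does (Q ≟S P) then n ℤ.+ coeff ξ P else coeff ξ P

_≈Ξ_ : FS → FS → Set
ξ ≈Ξ η = ∀ P → coeff ξ P ≡ coeff η P

deg : FS → ℤ
deg ξ = foldr (λ e acc → Data.Product.proj₁ e ℤ.+ acc) ℤ.0ℤ ξ

InΞ : FS → Set
InΞ ξ = All (λ e → IsSym (Data.Product.proj₂ e)) ξ

InΞ₀ : FS → Set
InΞ₀ ξ = InΞ ξ × deg ξ ≡ ℤ.0ℤ

_•Ξ_ : M2 → FS → FS
γ •Ξ ξ = map (λ { (n , P) → n , γ • P }) ξ

[_,_] : Sym → Sym → FS
[ c₁ , c₂ ] = (ℤ.+ 1 , c₂) ∷ (ℤ.-1ℤ , c₁) ∷ []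

module _ {m ℓ : Level} (V : Module ℚ-ring m ℓ) where
  open Module V

  record RightAction : Set (m ⊔ ℓ) where
    field
      _∣_    : Carrierᴹ → M2 → Carrierᴹ
      ∣-cong : ∀ {v w} g → GL2⁺ g → v ≈ᴹ w → (v ∣ g) ≈ᴹ (w ∣ g)
      ∣-id   : ∀ v → (v ∣ 1M) ≈ᴹ v
      ∣-mul  : ∀ v g h → GL2⁺ g → GL2⁺ h → (v ∣ (g *M h)) ≈ᴹ ((v ∣ g) ∣ h)
      ∣-+    : ∀ v w g → GL2⁺ g → ((v +ᴹ w) ∣ g) ≈ᴹ ((v ∣ g) +ᴹ (w ∣ g))
      ∣-*ₗ   : ∀ q v g → GL2⁺ g → ((q *ₗ v) ∣ g) ≈ᴹ (q *ₗ (v ∣ g))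

record Subgroup : Set₁ where
  field
    mem   : M2 → Set
    ⊆GL2⁺ : ∀ {g} → mem g → GL2⁺ g
    1∈    : mem 1M
    *∈    : ∀ {g h} → mem g → mem h → mem (g *M h)
    inv∈  : ∀ {g} → mem g → mem (inv g)

_∈H_ : M2 → Subgroup → Set
g ∈H H = Subgroup.mem H g

record SysRep (H : Subgroup) : Set₁ where
  field
    memD     : Sym → Set
    D⊆𝒫      : ∀ {Z} → memD Z → IsSym Z
    covers   : ∀ P → IsSym P → ∃[ h ] (h ∈H H × Σ Sym (λ Z → memD Z × h • P ≡ Z))
    distinct : ∀ {Z Z'} h → memD Z → memD Z' → h ∈H H → h • Z ≡ Z' → Z ≡ Z'

_∈D_ : {H : Subgroup} → Sym → SysRep H → Set
Z ∈D D = SysRep.memD D Z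

Transitive : Subgroup → Set
Transitive H = ∀ P Q → IsSym P → IsSym Q → ∃[ h ] (h ∈H H × h • P ≡ Q)

module _ {m ℓ : Level} (V : Module ℚ-ring m ℓ) (A : RightAction V) (H : Subgroup) where
  open Module V
  open RightAction A

  -- 1-cocycle of H with values in V (only values on H matter)
  IsCocycle : (M2 → Carrierᴹ) → Set ℓ
  IsCocycle c = ∀ g₁ g₂ → g₁ ∈H H → g₂ ∈H H →
                c (g₁ *M g₂) ≈ᴹ ((c g₁ ∣ g₂) +ᴹ c g₂)

  -- Ψ ∈ Hom_H(Ξ₀, V): Ψ is given on formal sums, only its values on Ξ₀ matter
  IsHomH : (FS → Carrierᴹ) → Set ℓ
  IsHomH Ψ =
      (∀ ξ η → InΞ₀ ξ → InΞ₀ η → ξ ≈Ξ η → Ψ ξ ≈ᴹ Ψ η)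
    × (∀ ξ η → InΞ₀ ξ → InΞ₀ η → Ψ (ξ ++ η) ≈ᴹ (Ψ ξ +ᴹ Ψ η))
    × (∀ γ ξ → γ ∈H H → InΞ₀ ξ → Ψ (γ •Ξ ξ) ≈ᴹ (Ψ ξ ∣ inv γ))

module Submission where

-- For a symbol P pick h ∈ H with h P ∈ 𝒟(H) and put F(P) = c(h).  This is
-- independent of h: two choices differ by an element of H stabilising an element of
-- 𝒟(H), on which c vanishes.  The cocycle relation gives F(γ P) = F(P)|γ⁻¹ + c(γ⁻¹), so
-- the linear extension Ψ of F satisfies Ψ(γ ξ) = Ψ(ξ)|γ⁻¹ + deg(ξ) c(γ⁻¹), which is
-- equivariance on Ξ₀; and Ψ [Z , γ⁻¹ Z] = F(γ⁻¹ Z) − F(Z) = c(γ) − c(1) = c(γ).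
--
-- Uniqueness.  Ξ₀ is generated by the elements [Z , P] for one fixed symbol Z, since
-- ξ = Σ nᵢ {Pᵢ} ∈ Ξ₀ equals Σ nᵢ [Z , Pᵢ]; so an additive map vanishing on them vanishes
-- on Ξ₀.  Under transitivity every P is h⁻¹ Z with h ∈ H, so Ψ [Z , P] = c(h) is forced.

open import Defs
open import Level using (Level; 0ℓ)
open import Data.Product using (_×_; ∃-syntax; Σ-syntax; _,_; proj₁; proj₂)
open import Data.List using ([]; _∷_; _++_; length)
open import Data.List.Relation.Unary.All using ([]; _∷_)
open import Data.Empty using (⊥-elim)
open import Relation.Nullary using (yes; no; does; ¬_)
open import Relation.Binary.PropositionalEquality hiding ([_])
open import Algebra.Bundles using (CommutativeMonoid)
open import Algebra.Module.Bundles using (Module)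

module ProjectiveLine where
  open import Data.Rational using (ℚ; 0ℚ; 1ℚ; _+_; _*_; _-_; -_; _÷_; 1/_; ≢-nonZero; NonZero)
  open import Data.Rational.Properties as ℚP using (_≟_; +-*-commutativeRing)
  open import Data.Maybe using (Maybe; just; nothing)
  open import Tactic.RingSolver using (solve-∀)
  open import Tactic.RingSolver.Core.AlmostCommutativeRing using (AlmostCommutativeRing; fromCommutativeRing)

  ℚ-solverRing : AlmostCommutativeRing 0ℓ 0ℓ
  ℚ-solverRing = fromCommutativeRing +-*-commutativeRing isZero
    where
    isZero : ∀ x → Maybe (0ℚ ≡ x)
    isZero x with 0ℚ ≟ x
    ... | yes p = just p
    ... | no _  = nothing

  ÷-*-cancel : ∀ x q .{{_ : NonZero q}} → (x ÷ q) * q ≡ x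
  ÷-*-cancel x q = begin
    x * 1/ q * q    ≡⟨ ℚP.*-assoc x (1/ q) q ⟩
    x * (1/ q * q)  ≡⟨ cong (x *_) (ℚP.*-inverseˡ q) ⟩
    x * 1ℚ          ≡⟨ ℚP.*-identityʳ x ⟩
    x               ∎
    where open ≡-Reasoning

  ÷-unique : ∀ y x q .{{_ : NonZero q}} → y * q ≡ x → y ≡ x ÷ q
  ÷-unique y x q yq≡x = begin
    y               ≡⟨ ℚP.*-identityʳ y ⟨
    y * 1ℚ          ≡⟨ cong (y *_) (ℚP.*-inverseʳ q) ⟨
    y * (q * 1/ q)  ≡⟨ ℚP.*-assoc y q (1/ q) ⟨
    y * q * 1/ q    ≡⟨ cong (_* 1/ q) yq≡x ⟩
    x ÷ q           ∎
    where open ≡-Reasoning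

  *-zero-cancelˡ : ∀ e y → e ≢ 0ℚ → e * y ≡ 0ℚ → y ≡ 0ℚ
  *-zero-cancelˡ e y e≢0 ey≡0 = let instance _ = ≢-nonZero e≢0 in begin
    y               ≡⟨ ÷-unique y 0ℚ e (trans (ℚP.*-comm y e) ey≡0) ⟩
    0ℚ ÷ e          ≡⟨ ℚP.*-zeroˡ (1/ e) ⟩
    0ℚ              ∎
    where open ≡-Reasoning

  -- Homogeneous coordinates: a point of ℙ¹(ℚ) is the line through a nonzero
  -- vector (u , v) of ℚ², and matrices act on ℚ² linearly.

  ℚ² : Set
  ℚ² = ℚ × ℚ

  Nonzero : ℚ² → Set
  Nonzero (u , v) = ¬ (u ≡ 0ℚ × v ≡ 0ℚ)

  proj : ℚ² → ℙ¹
  proj (u , v) with v ≟ 0ℚ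
  ... | yes _  = ∞
  ... | no v≢0 = fin ((u ÷ v) {{≢-nonZero v≢0}})

  lift : ℙ¹ → ℚ²
  lift ∞       = 1ℚ , 0ℚ
  lift (fin t) = t , 1ℚ

  _⋆_ : ℚ → ℚ² → ℚ²
  e ⋆ (u , v) = e * u , e * v

  _·_ : M2 → ℚ² → ℚ²
  mat a b c d · (u , v) = a * u + b * v , c * u + d * v

  proj-⋆ : ∀ e w → e ≢ 0ℚ → proj (e ⋆ w) ≡ proj w
  proj-⋆ e (u , v) e≢0 with v ≟ 0ℚ | e * v ≟ 0ℚ
  ... | yes _   | yes _   = refl
  ... | yes v≡0 | no ev≢0 = ⊥-elim (ev≢0 (trans (cong (e *_) v≡0) (ℚP.*-zeroʳ e)))
  ... | no v≢0  | yes ev≡0 = ⊥-elim (v≢0 (*-zero-cancelˡ e v e≢0 ev≡0))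
  ... | no v≢0  | no ev≢0 =
    let instance _ = ≢-nonZero v≢0; _ = ≢-nonZero ev≢0 in
    cong fin (sym (÷-unique (u ÷ v) (e * u) (e * v) (begin
      (u ÷ v) * (e * v)  ≡⟨ swap (u ÷ v) e v ⟩
      e * ((u ÷ v) * v)  ≡⟨ cong (e *_) (÷-*-cancel u v) ⟩
      e * u              ∎)))
    where
    open ≡-Reasoning
    swap : ∀ (x y z : ℚ) → x * (y * z) ≡ y * (x * z)
    swap = solve-∀ ℚ-solverRing

  proj-lift : ∀ x → proj (lift x) ≡ x
  proj-lift ∞ = refl
  proj-lift (fin t) = cong fin (ℚP.*-identityʳ t)

  lift-proj : ∀ w → Nonzero w → Σ[ e ∈ ℚ ] (e ≢ 0ℚ × w ≡ e ⋆ lift (proj w))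
  lift-proj (u , v) w≢0 with v ≟ 0ℚ
  ... | yes v≡0 = u , (λ u≡0 → w≢0 (u≡0 , v≡0))
                    , cong₂ _,_ (sym (ℚP.*-identityʳ u)) (trans v≡0 (sym (ℚP.*-zeroʳ u)))
  ... | no v≢0 = let instance _ = ≢-nonZero v≢0 in
    v , v≢0 , cong₂ _,_ (sym (trans (ℚP.*-comm v (u ÷ v)) (÷-*-cancel u v))) (sym (ℚP.*-identityʳ v))

  lift-nonzero : ∀ x → Nonzero (lift x)
  lift-nonzero ∞       (1≡0 , _) = ℚP.1≢0 1≡0
  lift-nonzero (fin t) (_ , 1≡0) = ℚP.1≢0 1≡0

  ·-⋆ : ∀ g e w → g · (e ⋆ w) ≡ e ⋆ (g · w)
  ·-⋆ (mat a b c d) e (u , v) = cong₂ _,_ (lin a b e u v) (lin c d e u v)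
    where
    lin : ∀ a b e u v → a * (e * u) + b * (e * v) ≡ e * (a * u + b * v)
    lin = solve-∀ ℚ-solverRing

  ·-*M : ∀ g h w → (g *M h) · w ≡ g · (h · w)
  ·-*M (mat a b c d) (mat p q r s) (u , v) = cong₂ _,_ (row a b p q r s u v) (row c d p q r s u v)
    where
    row : ∀ a b p q r s u v →
      (a * p + b * r) * u + (a * q + b * s) * v ≡ a * (p * u + q * v) + b * (r * u + s * v)
    row = solve-∀ ℚ-solverRing

  -- An invertible matrix maps nonzero vectors to nonzero vectors:
  -- det h · u and det h · v are linear combinations of the entries of h · w.
  ·-nonzero : ∀ h w → det h ≢ 0ℚ → Nonzero w → Nonzero (h · w)
  ·-nonzero (mat a b c d) (u , v) det≢0 w≢0 (x≡0 , y≡0) =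
    w≢0 ( *-zero-cancelˡ _ u det≢0 (trans (cramerᵤ a b c d u v) (combine d (- b) x≡0 y≡0))
        , *-zero-cancelˡ _ v det≢0 (trans (cramerᵥ a b c d u v) (combine a (- c) y≡0 x≡0)) )
    where
    cramerᵤ : ∀ a b c d u v → (a * d - b * c) * u ≡ d * (a * u + b * v) + (- b) * (c * u + d * v)
    cramerᵤ = solve-∀ ℚ-solverRing
    cramerᵥ : ∀ a b c d u v → (a * d - b * c) * v ≡ a * (c * u + d * v) + (- c) * (a * u + b * v)
    cramerᵥ = solve-∀ ℚ-solverRing
    combine : ∀ k l {x y} → x ≡ 0ℚ → y ≡ 0ℚ → k * x + l * y ≡ 0ℚ
    combine k l refl refl = trans (cong₂ _+_ (ℚP.*-zeroʳ k) (ℚP.*-zeroʳ l)) (ℚP.+-identityʳ 0ℚ)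

  mob-proj : ∀ g x → mob g x ≡ proj (g · lift x)
  mob-proj (mat a b c d) ∞ = trans (atInfinity a c) (cong proj (cong₂ _,_ (e₁ a b) (e₁ c d)))
    where
    atInfinity : ∀ a c → mob (mat a b c d) ∞ ≡ proj (a , c)
    atInfinity a c with c ≟ 0ℚ
    ... | yes _ = refl
    ... | no _  = refl
    e₁ : ∀ a b → a ≡ a * 1ℚ + b * 0ℚ
    e₁ = solve-∀ ℚ-solverRing
  mob-proj (mat a b c d) (fin t) = trans atFinite (cong proj (cong₂ _,_ (e₂ a b t) (e₂ c d t)))
    where
    atFinite : mob (mat a b c d) (fin t) ≡ proj (a * t + b , c * t + d)
    atFinite with c * t + d ≟ 0ℚ
    ... | yes _ = refl
    ... | no _  = refl
    e₂ : ∀ a b t → a * t + b ≡ a * t + b * 1ℚ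
    e₂ = solve-∀ ℚ-solverRing

  mob-*M : ∀ g h x → det h ≢ 0ℚ → mob (g *M h) x ≡ mob g (mob h x)
  mob-*M g h x det≢0 with lift-proj (h · lift x) (·-nonzero h (lift x) det≢0 (lift-nonzero x))
  ... | e , e≢0 , hx≡ = begin
    mob (g *M h) x                    ≡⟨ mob-proj (g *M h) x ⟩
    proj ((g *M h) · lift x)          ≡⟨ cong proj (·-*M g h (lift x)) ⟩
    proj (g · (h · lift x))           ≡⟨ cong (λ w → proj (g · w)) hx≡ ⟩
    proj (g · (e ⋆ lift y))           ≡⟨ cong proj (·-⋆ g e (lift y)) ⟩
    proj (e ⋆ (g · lift y))           ≡⟨ proj-⋆ e (g · lift y) e≢0 ⟩
    proj (g · lift y)                 ≡⟨ mob-proj g y ⟨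
    mob g y                           ≡⟨ cong (mob g) (mob-proj h x) ⟨
    mob g (mob h x)                   ∎
    where
    open ≡-Reasoning
    y : ℙ¹
    y = proj (h · lift x)

  mob-1M : ∀ x → mob 1M x ≡ x
  mob-1M x = begin
    mob 1M x            ≡⟨ mob-proj 1M x ⟩
    proj (1M · lift x)  ≡⟨ cong proj (·-1M (lift x)) ⟩
    proj (lift x)       ≡⟨ proj-lift x ⟩
    x                   ∎
    where
    open ≡-Reasoning
    unitˡ : ∀ u v → 1ℚ * u + 0ℚ * v ≡ u
    unitˡ = solve-∀ ℚ-solverRing
    unitʳ : ∀ u v → 0ℚ * u + 1ℚ * v ≡ v
    unitʳ = solve-∀ ℚ-solverRing
    ·-1M : ∀ w → 1M · w ≡ w
    ·-1M (u , v) = cong₂ _,_ (unitˡ u v) (unitʳ u v)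

  mat-≡ : ∀ {a b c d a′ b′ c′ d′} → a ≡ a′ → b ≡ b′ → c ≡ c′ → d ≡ d′ → mat a b c d ≡ mat a′ b′ c′ d′
  mat-≡ refl refl refl refl = refl

  *M-assoc : ∀ g h k → (g *M h) *M k ≡ g *M (h *M k)
  *M-assoc (mat a b c d) (mat p q r s) (mat x y z t) =
    mat-≡ (entry a b p q r s x z) (entry a b p q r s y t) (entry c d p q r s x z) (entry c d p q r s y t)
    where
    entry : ∀ a b p q r s x z →
      (a * p + b * r) * x + (a * q + b * s) * z ≡ a * (p * x + q * z) + b * (r * x + s * z)
    entry = solve-∀ ℚ-solverRing

  *M-identityʳ : ∀ g → g *M 1M ≡ g
  *M-identityʳ (mat a b c d) = mat-≡ (left a b) (right a b) (left c d) (right c d)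
    where
    left : ∀ a b → a * 1ℚ + b * 0ℚ ≡ a
    left = solve-∀ ℚ-solverRing
    right : ∀ a b → a * 0ℚ + b * 1ℚ ≡ b
    right = solve-∀ ℚ-solverRing

  scaledAdjugate : ℚ → M2 → M2
  scaledAdjugate w (mat a b c d) = mat (d * w) ((- b) * w) ((- c) * w) (a * w)

  scaledAdjugate-*ˡ : ∀ g w → det g * w ≡ 1ℚ → scaledAdjugate w g *M g ≡ 1M
  scaledAdjugate-*ˡ (mat a b c d) w Δw≡1 =
    mat-≡ (trans (diagonal₁ a b c d w) Δw≡1) (offDiagonalˡ d b w)
          (trans (ℚP.+-comm ((- c) * w * a) (a * w * c)) (offDiagonalˡ a c w)) (trans (diagonal₂ a b c d w) Δw≡1)
    where
    diagonal₁ : ∀ a b c d w → (d * w) * a + ((- b) * w) * c ≡ (a * d - b * c) * w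
    diagonal₁ = solve-∀ ℚ-solverRing
    diagonal₂ : ∀ a b c d w → ((- c) * w) * b + (a * w) * d ≡ (a * d - b * c) * w
    diagonal₂ = solve-∀ ℚ-solverRing
    offDiagonalˡ : ∀ a b w → (a * w) * b + ((- b) * w) * a ≡ 0ℚ
    offDiagonalˡ = solve-∀ ℚ-solverRing

  scaledAdjugate-*ʳ : ∀ g w → det g * w ≡ 1ℚ → g *M scaledAdjugate w g ≡ 1M
  scaledAdjugate-*ʳ (mat a b c d) w Δw≡1 =
    mat-≡ (trans (diagonal₃ a b c d w) Δw≡1) (offDiagonalʳ a b w)
          (trans (ℚP.+-comm (c * (d * w)) (d * ((- c) * w))) (offDiagonalʳ d c w)) (trans (diagonal₄ a b c d w) Δw≡1)
    where
    diagonal₃ : ∀ a b c d w → a * (d * w) + b * ((- c) * w) ≡ (a * d - b * c) * w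
    diagonal₃ = solve-∀ ℚ-solverRing
    diagonal₄ : ∀ a b c d w → c * ((- b) * w) + d * (a * w) ≡ (a * d - b * c) * w
    diagonal₄ = solve-∀ ℚ-solverRing
    offDiagonalʳ : ∀ a b w → a * ((- b) * w) + b * (a * w) ≡ 0ℚ
    offDiagonalʳ = solve-∀ ℚ-solverRing

  inv-adjugate : ∀ g (det≢0 : det g ≢ 0ℚ) → inv g ≡ scaledAdjugate ((1/ det g) {{≢-nonZero det≢0}}) g
  inv-adjugate g det≢0 with det g ≟ 0ℚ
  ... | yes det≡0 = ⊥-elim (det≢0 det≡0)
  ... | no _      = refl

  inv-*ˡ : ∀ g → det g ≢ 0ℚ → inv g *M g ≡ 1M
  inv-*ˡ g det≢0 = let instance _ = ≢-nonZero det≢0 in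
    trans (cong (_*M g) (inv-adjugate g det≢0)) (scaledAdjugate-*ˡ g _ (ℚP.*-inverseʳ (det g)))

  inv-*ʳ : ∀ g → det g ≢ 0ℚ → g *M inv g ≡ 1M
  inv-*ʳ g det≢0 = let instance _ = ≢-nonZero det≢0 in
    trans (cong (g *M_) (inv-adjugate g det≢0)) (scaledAdjugate-*ʳ g _ (ℚP.*-inverseʳ (det g)))

  •-*M : ∀ g h P → det h ≢ 0ℚ → (g *M h) • P ≡ g • (h • P)
  •-*M g h (r , s) det≢0 = cong₂ _,_ (mob-*M g h r det≢0) (mob-*M g h s det≢0)

  •-1M : ∀ P → 1M • P ≡ P
  •-1M (r , s) = cong₂ _,_ (mob-1M r) (mob-1M s)

  mob-undo : ∀ h g x → det g ≢ 0ℚ → h *M g ≡ 1M → mob h (mob g x) ≡ x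
  mob-undo h g x det≢0 hg≡1 =
    trans (sym (mob-*M h g x det≢0)) (trans (cong (λ k → mob k x) hg≡1) (mob-1M x))

  •-undo : ∀ h g P → det g ≢ 0ℚ → h *M g ≡ 1M → h • (g • P) ≡ P
  •-undo h g (r , s) det≢0 hg≡1 = cong₂ _,_ (mob-undo h g r det≢0 hg≡1) (mob-undo h g s det≢0 hg≡1)

  -- Invertible matrices map symbols to symbols, since mob g is injective.
  •-IsSym : ∀ g P → det g ≢ 0ℚ → IsSym P → IsSym (g • P)
  •-IsSym g (r , s) det≢0 r≢s gr≡gs =
    r≢s (trans (sym (undo r)) (trans (cong (mob (inv g)) gr≡gs) (undo s)))
    where
    undo : ∀ x → mob (inv g) (mob g x) ≡ x
    undo x = mob-undo (inv g) g x det≢0 (inv-*ˡ g det≢0)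

  GL2⁺⇒det≢0 : ∀ g → GL2⁺ g → det g ≢ 0ℚ
  GL2⁺⇒det≢0 g 0<det det≡0 = ℚP.<-irrefl (sym det≡0) 0<det


module FormalSums where
  open import Data.Bool using (Bool; true; false; if_then_else_)
  open import Data.Integer using (ℤ; 0ℤ; 1ℤ; _+_; _*_; -_)
  import Data.Integer.Properties as ℤP
  open import Data.Integer.Tactic.RingSolver using (solve-∀)
  open import Data.Rational.Literals using (fromℤ)
  import Data.Rational as ℚ
  import Data.Rational.Properties as ℚP
  import Data.Rational.Unnormalised as ℚᵘ
  import Data.Rational.Unnormalised.Properties as ℚᵘP
  open import Data.Nat as ℕ using (ℕ; suc; z≤n; s≤s)
  import Data.Nat.Properties as ℕP
  open import Data.List.Relation.Unary.All.Properties using (++⁺)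

  select : Bool → ℤ → ℤ
  select b n = if b then n else 0ℤ

  select-+ : ∀ b m n → select b (m + n) ≡ select b m + select b n
  select-+ true  m n = refl
  select-+ false m n = refl

  select-neg : ∀ b n → select b (- n) ≡ - select b n
  select-neg true  n = refl
  select-neg false n = refl

  select-zero : ∀ b → select b 0ℤ ≡ 0ℤ
  select-zero true  = refl
  select-zero false = refl

  coeff-∷ : ∀ n Q ξ P → coeff ((n , Q) ∷ ξ) P ≡ select (does (Q ≟S P)) n + coeff ξ P
  coeff-∷ n Q ξ P with does (Q ≟S P)
  ... | true  = refl
  ... | false = sym (ℤP.+-identityˡ _)

  coeff-++ : ∀ ξ η P → coeff (ξ ++ η) P ≡ coeff ξ P + coeff η P
  coeff-++ [] η P = sym (ℤP.+-identityˡ _)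
  coeff-++ ((n , Q) ∷ ξ) η P with does (Q ≟S P)
  ... | true  = trans (cong (n +_) (coeff-++ ξ η P)) (sym (ℤP.+-assoc n _ _))
  ... | false = coeff-++ ξ η P

  deg-++ : ∀ ξ η → deg (ξ ++ η) ≡ deg ξ + deg η
  deg-++ [] η = sym (ℤP.+-identityˡ _)
  deg-++ ((n , P) ∷ ξ) η = trans (cong (n +_) (deg-++ ξ η)) (sym (ℤP.+-assoc n _ _))

  Ξ₀-++ : ∀ {ξ η} → InΞ₀ ξ → InΞ₀ η → InΞ₀ (ξ ++ η)
  Ξ₀-++ {ξ} {η} (ξ-sym , degξ≡0) (η-sym , degη≡0) =
    ++⁺ ξ-sym η-sym , trans (deg-++ ξ η) (cong₂ _+_ degξ≡0 degη≡0)

  -- Removing every occurrence of a symbol: this kills its coefficient and keeps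
  -- all others, and is the induction step for comparing equal formal sums.

  remove : Sym → FS → FS
  remove P [] = []
  remove P ((n , Q) ∷ ξ) = if does (Q ≟S P) then remove P ξ else (n , Q) ∷ remove P ξ

  length-remove : ∀ P ξ → length (remove P ξ) ℕ.≤ length ξ
  length-remove P [] = z≤n
  length-remove P ((n , Q) ∷ ξ) with does (Q ≟S P)
  ... | true  = ℕP.m≤n⇒m≤1+n (length-remove P ξ)
  ... | false = s≤s (length-remove P ξ)

  remove-head : ∀ n P ξ → remove P ((n , P) ∷ ξ) ≡ remove P ξ
  remove-head n P ξ with P ≟S P
  ... | yes _   = refl
  ... | no P≢P = ⊥-elim (P≢P refl)

  coeff-∷-≢ : ∀ n Q ξ P → ¬ Q ≡ P → coeff ((n , Q) ∷ ξ) P ≡ coeff ξ P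
  coeff-∷-≢ n Q ξ P Q≢P with Q ≟S P
  ... | yes Q≡P = ⊥-elim (Q≢P Q≡P)
  ... | no _    = refl

  coeff-remove-same : ∀ P ξ → coeff (remove P ξ) P ≡ 0ℤ
  coeff-remove-same P [] = refl
  coeff-remove-same P ((n , Q) ∷ ξ) with Q ≟S P
  ... | yes _   = coeff-remove-same P ξ
  ... | no Q≢P = trans (coeff-∷-≢ n Q (remove P ξ) P Q≢P) (coeff-remove-same P ξ)

  coeff-remove-other : ∀ P R ξ → ¬ R ≡ P → coeff (remove P ξ) R ≡ coeff ξ R
  coeff-remove-other P R [] R≢P = refl
  coeff-remove-other P R ((n , Q) ∷ ξ) R≢P with Q ≟S P
  ... | yes refl = trans (coeff-remove-other P R ξ R≢P) (sym (coeff-∷-≢ n Q ξ R (λ Q≡R → R≢P (sym Q≡R))))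
  ... | no _     = begin
    coeff ((n , Q) ∷ remove P ξ) R                ≡⟨ coeff-∷ n Q (remove P ξ) R ⟩
    select (does (Q ≟S R)) n + coeff (remove P ξ) R ≡⟨ cong (select (does (Q ≟S R)) n +_) (coeff-remove-other P R ξ R≢P) ⟩
    select (does (Q ≟S R)) n + coeff ξ R          ≡⟨ coeff-∷ n Q ξ R ⟨
    coeff ((n , Q) ∷ ξ) R                         ∎
    where open ≡-Reasoning

  remove-≈Ξ : ∀ P {ξ η} → ξ ≈Ξ η → remove P ξ ≈Ξ remove P η
  remove-≈Ξ P {ξ} {η} ξ≈η R with R ≟S P
  ... | yes refl = trans (coeff-remove-same R ξ) (sym (coeff-remove-same R η))
  ... | no R≢P  = trans (coeff-remove-other P R ξ R≢P) (trans (ξ≈η R) (sym (coeff-remove-other P R η R≢P)))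

  fromℤ-+ : ∀ m n → fromℤ (m + n) ≡ fromℤ m ℚ.+ fromℤ n
  fromℤ-+ m n = ℚP.toℚᵘ-injective
    (ℚᵘP.≃-trans (ℚᵘ.*≡* (unitDenominators m n)) (ℚᵘP.≃-sym (ℚP.toℚᵘ-homo-+ (fromℤ m) (fromℤ n))))
    where
    unitDenominators : ∀ m n → (m + n) * 1ℤ ≡ (m * 1ℤ + n * 1ℤ) * 1ℤ
    unitDenominators = solve-∀

  module LinearExtension {m ℓ : Level} (V : Module ℚ-ring m ℓ) where
    open Module V
    open import Relation.Binary.Reasoning.Setoid ≈ᴹ-setoid
    open import Algebra.Properties.CommutativeSemigroup
      (CommutativeMonoid.commutativeSemigroup +ᴹ-commutativeMonoid) using (x∙yz≈y∙xz)

    infixr 8 _×ᶻ_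
    _×ᶻ_ : ℤ → Carrierᴹ → Carrierᴹ
    n ×ᶻ v = fromℤ n *ₗ v

    ×ᶻ-distribʳ : ∀ m n v → (m + n) ×ᶻ v ≈ᴹ m ×ᶻ v +ᴹ n ×ᶻ v
    ×ᶻ-distribʳ m n v = ≈ᴹ-trans (≈ᴹ-reflexive (cong (_*ₗ v) (fromℤ-+ m n))) (*ₗ-distribʳ v (fromℤ m) (fromℤ n))

    module _ (F : Sym → Carrierᴹ) where

      extend : FS → Carrierᴹ
      extend [] = 0ᴹ
      extend ((n , P) ∷ ξ) = n ×ᶻ F P +ᴹ extend ξ

      extend-++ : ∀ ξ η → extend (ξ ++ η) ≈ᴹ extend ξ +ᴹ extend η
      extend-++ [] η = ≈ᴹ-sym (+ᴹ-identityˡ _)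
      extend-++ ((n , P) ∷ ξ) η = ≈ᴹ-trans (+ᴹ-congˡ (extend-++ ξ η)) (≈ᴹ-sym (+ᴹ-assoc _ _ _))

      extend-remove : ∀ P ξ → extend ξ ≈ᴹ coeff ξ P ×ᶻ F P +ᴹ extend (remove P ξ)
      extend-remove P [] = ≈ᴹ-sym (≈ᴹ-trans (+ᴹ-identityʳ _) (*ₗ-zeroˡ (F P)))
      extend-remove P ((n , Q) ∷ ξ) with Q ≟S P
      ... | yes refl = begin
        n ×ᶻ F Q +ᴹ extend ξ                                   ≈⟨ +ᴹ-congˡ (extend-remove Q ξ) ⟩
        n ×ᶻ F Q +ᴹ (coeff ξ Q ×ᶻ F Q +ᴹ extend (remove Q ξ))  ≈⟨ +ᴹ-assoc _ _ _ ⟨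
        (n ×ᶻ F Q +ᴹ coeff ξ Q ×ᶻ F Q) +ᴹ extend (remove Q ξ)  ≈⟨ +ᴹ-congʳ (×ᶻ-distribʳ n _ (F Q)) ⟨
        (n + coeff ξ Q) ×ᶻ F Q +ᴹ extend (remove Q ξ)          ∎
      ... | no _ = begin
        n ×ᶻ F Q +ᴹ extend ξ                                   ≈⟨ +ᴹ-congˡ (extend-remove P ξ) ⟩
        n ×ᶻ F Q +ᴹ (coeff ξ P ×ᶻ F P +ᴹ extend (remove P ξ))  ≈⟨ x∙yz≈y∙xz _ _ _ ⟩
        coeff ξ P ×ᶻ F P +ᴹ (n ×ᶻ F Q +ᴹ extend (remove P ξ))  ∎

      -- extend only depends on the coefficients: induction on the total length,
      -- removing the first symbol from both sides.
      private
        Bounded : ℕ → Set ℓ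
        Bounded k = ∀ ξ η → length ξ ℕ.+ length η ℕ.≤ k → ξ ≈Ξ η → extend ξ ≈ᴹ extend η

        removeHead : ∀ k → Bounded k → ∀ n P ξ η → length ξ ℕ.+ length η ℕ.≤ k →
                     ((n , P) ∷ ξ) ≈Ξ η → extend ((n , P) ∷ ξ) ≈ᴹ extend η
        removeHead k bounded n P ξ η bound ξ≈η = begin
          extend ξ′                                         ≈⟨ extend-remove P ξ′ ⟩
          coeff ξ′ P ×ᶻ F P +ᴹ extend (remove P ξ′)         ≈⟨ +ᴹ-cong (≈ᴹ-reflexive (cong (_×ᶻ F P) (ξ≈η P)))
                                                                      (bounded (remove P ξ′) (remove P η) shorter
                                                                         (remove-≈Ξ P {ξ′} {η} ξ≈η)) ⟩
          coeff η P ×ᶻ F P +ᴹ extend (remove P η)           ≈⟨ extend-remove P η ⟨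
          extend η                                          ∎
          where
          ξ′ : FS
          ξ′ = (n , P) ∷ ξ
          shorter : length (remove P ξ′) ℕ.+ length (remove P η) ℕ.≤ k
          shorter rewrite remove-head n P ξ =
            ℕP.≤-trans (ℕP.+-mono-≤ (length-remove P ξ) (length-remove P η)) bound

        bounded : ∀ k → Bounded k
        bounded k [] [] _ _ = ≈ᴹ-refl
        bounded (suc k) ((n , P) ∷ ξ) η (s≤s bound) ξ≈η = removeHead k (bounded k) n P ξ η bound ξ≈η
        bounded (suc k) [] ((n , P) ∷ η) (s≤s bound) ξ≈η =
          ≈ᴹ-sym (removeHead k (bounded k) n P η [] (subst (ℕ._≤ k) (sym (ℕP.+-identityʳ _)) bound)
                             (λ R → sym (ξ≈η R)))

      extend-≈Ξ : ∀ ξ η → ξ ≈Ξ η → extend ξ ≈ᴹ extend η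
      extend-≈Ξ ξ η = bounded (length ξ ℕ.+ length η) ξ η ℕP.≤-refl


open ProjectiveLine
open FormalSums

module Generators where
  open import Data.Bool using (Bool)
  open import Data.Integer as ℤ using (ℤ; 0ℤ; 1ℤ; _+_; _-_; -_)
  open import Data.Nat using (zero; suc)
  import Data.Integer.Properties as ℤP
  open import Data.Integer.Tactic.RingSolver using (solve-∀)

  -- The generators n ({P} − {Z}) of Ξ₀ relative to a base symbol Z; [Z , P] is piece 1ℤ Z P.
  piece : ℤ → Sym → Sym → FS
  piece n Z P = (n , P) ∷ (- n , Z) ∷ []

  coeff-piece : ∀ n Z P Q → coeff (piece n Z P) Q ≡ select (does (P ≟S Q)) n - select (does (Z ≟S Q)) n
  coeff-piece n Z P Q = begin
    coeff (piece n Z P) Q                                        ≡⟨ coeff-∷ n P ((- n , Z) ∷ []) Q ⟩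
    select bP n + coeff ((- n , Z) ∷ []) Q                       ≡⟨ cong (select bP n +_) (coeff-∷ (- n) Z [] Q) ⟩
    select bP n + (select bZ (- n) + 0ℤ)                         ≡⟨ cong (select bP n +_) (ℤP.+-identityʳ _) ⟩
    select bP n + select bZ (- n)                                ≡⟨ cong (select bP n +_) (select-neg bZ n) ⟩
    select bP n - select bZ n                                    ∎
    where
    open ≡-Reasoning
    bP bZ : Bool
    bP = does (P ≟S Q)
    bZ = does (Z ≟S Q)

  piece-Ξ₀ : ∀ n {Z P} → IsSym Z → IsSym P → InΞ₀ (piece n Z P)
  piece-Ξ₀ n Z-sym P-sym = (P-sym ∷ Z-sym ∷ []) , trans (cong (n +_) (ℤP.+-identityʳ (- n))) (ℤP.+-inverseʳ n)

  piece-+ : ∀ m n Z P → piece (m + n) Z P ≈Ξ (piece m Z P ++ piece n Z P)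
  piece-+ m n Z P Q = begin
    coeff (piece (m + n) Z P) Q                          ≡⟨ coeff-piece (m + n) Z P Q ⟩
    select bP (m + n) - select bZ (m + n)                ≡⟨ cong₂ _-_ (select-+ bP m n) (select-+ bZ m n) ⟩
    (select bP m + select bP n) - (select bZ m + select bZ n)
                                                         ≡⟨ regroup (select bP m) (select bP n) (select bZ m) (select bZ n) ⟩
    (select bP m - select bZ m) + (select bP n - select bZ n)
                                                         ≡⟨ cong₂ _+_ (coeff-piece m Z P Q) (coeff-piece n Z P Q) ⟨
    coeff (piece m Z P) Q + coeff (piece n Z P) Q        ≡⟨ coeff-++ (piece m Z P) (piece n Z P) Q ⟨
    coeff (piece m Z P ++ piece n Z P) Q                 ∎
    where
    open ≡-Reasoning
    bP bZ : Bool
    bP = does (P ≟S Q)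
    bZ = does (Z ≟S Q)
    regroup : ∀ a b c d → (a + b) - (c + d) ≡ (a - c) + (b - d)
    regroup = solve-∀

  piece-0 : ∀ Z P → piece 0ℤ Z P ≈Ξ []
  piece-0 Z P Q = trans (coeff-piece 0ℤ Z P Q)
                        (cong₂ _-_ (select-zero (does (P ≟S Q))) (select-zero (does (Z ≟S Q))))

  -- Every formal sum ξ = Σ nᵢ {Pᵢ} is rewritten as Σ nᵢ ({Pᵢ} − {Z}), which differs
  -- from ξ by deg(ξ) {Z}; on Ξ₀ the two are equal.
  pieces : Sym → FS → FS
  pieces Z [] = []
  pieces Z ((n , P) ∷ ξ) = piece n Z P ++ pieces Z ξ

  coeff-pieces : ∀ Z ξ Q → coeff (pieces Z ξ) Q ≡ coeff ξ Q - select (does (Z ≟S Q)) (deg ξ)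
  coeff-pieces Z [] Q = cong (λ n → 0ℤ - n) (sym (select-zero (does (Z ≟S Q))))
  coeff-pieces Z ((n , P) ∷ ξ) Q = begin
    coeff (piece n Z P ++ pieces Z ξ) Q                        ≡⟨ coeff-++ (piece n Z P) (pieces Z ξ) Q ⟩
    coeff (piece n Z P) Q + coeff (pieces Z ξ) Q               ≡⟨ cong₂ _+_ (coeff-piece n Z P Q) (coeff-pieces Z ξ Q) ⟩
    (select bP n - select bZ n) + (coeff ξ Q - select bZ (deg ξ))
                                                               ≡⟨ regroup (select bP n) (select bZ n) (coeff ξ Q) (select bZ (deg ξ)) ⟩
    (select bP n + coeff ξ Q) - (select bZ n + select bZ (deg ξ))
                                                               ≡⟨ cong₂ _-_ (coeff-∷ n P ξ Q) (select-+ bZ n (deg ξ)) ⟨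
    coeff ((n , P) ∷ ξ) Q - select bZ (n + deg ξ)              ∎
    where
    open ≡-Reasoning
    bP bZ : Bool
    bP = does (P ≟S Q)
    bZ = does (Z ≟S Q)
    regroup : ∀ a b c d → (a - b) + (c - d) ≡ (a + c) - (b + d)
    regroup = solve-∀

  pieces-≈Ξ : ∀ Z ξ → deg ξ ≡ 0ℤ → ξ ≈Ξ pieces Z ξ
  pieces-≈Ξ Z ξ deg≡0 Q = sym (begin
    coeff (pieces Z ξ) Q                         ≡⟨ coeff-pieces Z ξ Q ⟩
    coeff ξ Q - select (does (Z ≟S Q)) (deg ξ)   ≡⟨ cong (λ n → coeff ξ Q - select (does (Z ≟S Q)) n) deg≡0 ⟩
    coeff ξ Q - select (does (Z ≟S Q)) 0ℤ        ≡⟨ cong (λ n → coeff ξ Q - n) (select-zero (does (Z ≟S Q))) ⟩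
    coeff ξ Q - 0ℤ                               ≡⟨ ℤP.+-identityʳ (coeff ξ Q) ⟩
    coeff ξ Q                                    ∎)
    where open ≡-Reasoning

  pieces-Ξ₀ : ∀ {Z} ξ → IsSym Z → InΞ ξ → InΞ₀ (pieces Z ξ)
  pieces-Ξ₀ [] Z-sym [] = [] , refl
  pieces-Ξ₀ ((n , P) ∷ ξ) Z-sym (P-sym ∷ ξ-sym) = Ξ₀-++ (piece-Ξ₀ n Z-sym P-sym) (pieces-Ξ₀ ξ Z-sym ξ-sym)

  module _ {m ℓ : Level} (V : Module ℚ-ring m ℓ) where
    open Module V
    open import Relation.Binary.Reasoning.Setoid ≈ᴹ-setoid
    open import Algebra.Properties.AbelianGroup +ᴹ-abelianGroup
      using (identityˡ-unique; ⁻¹-∙-comm; x∙y⁻¹≈ε⇒x≈y; x≈y⇒x∙y⁻¹≈ε)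
    open import Algebra.Properties.CommutativeSemigroup
      (CommutativeMonoid.commutativeSemigroup +ᴹ-commutativeMonoid) using (interchange)

    IsAdditive : (FS → Carrierᴹ) → Set ℓ
    IsAdditive Φ = (∀ ξ η → InΞ₀ ξ → InΞ₀ η → ξ ≈Ξ η → Φ ξ ≈ᴹ Φ η)
                 × (∀ ξ η → InΞ₀ ξ → InΞ₀ η → Φ (ξ ++ η) ≈ᴹ Φ ξ +ᴹ Φ η)

    difference-additive : ∀ Φ Φ′ → IsAdditive Φ → IsAdditive Φ′ → IsAdditive (λ ξ → Φ ξ +ᴹ -ᴹ Φ′ ξ)
    difference-additive Φ Φ′ (Φ-resp , Φ-++) (Φ′-resp , Φ′-++) =
      (λ ξ η ξ∈ η∈ ξ≈η → +ᴹ-cong (Φ-resp ξ η ξ∈ η∈ ξ≈η) (-ᴹ‿cong (Φ′-resp ξ η ξ∈ η∈ ξ≈η)))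
      , λ ξ η ξ∈ η∈ → begin
        Φ (ξ ++ η) +ᴹ -ᴹ Φ′ (ξ ++ η)                     ≈⟨ +ᴹ-cong (Φ-++ ξ η ξ∈ η∈) (-ᴹ‿cong (Φ′-++ ξ η ξ∈ η∈)) ⟩
        (Φ ξ +ᴹ Φ η) +ᴹ -ᴹ (Φ′ ξ +ᴹ Φ′ η)                ≈⟨ +ᴹ-congˡ (⁻¹-∙-comm (Φ′ ξ) (Φ′ η)) ⟨
        (Φ ξ +ᴹ Φ η) +ᴹ (-ᴹ Φ′ ξ +ᴹ -ᴹ Φ′ η)          ≈⟨ interchange _ _ _ _ ⟩
        (Φ ξ +ᴹ -ᴹ Φ′ ξ) +ᴹ (Φ η +ᴹ -ᴹ Φ′ η)          ∎

    -- An additive map on Ξ₀ vanishing on all [Z , P] (for a fixed symbol Z)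
    -- vanishes on Ξ₀: Ξ₀ is generated by these elements.
    module Vanishing (Φ : FS → Carrierᴹ) (Φ-additive : IsAdditive Φ) {Z : Sym} (Z-sym : IsSym Z)
      (Φ-[Z,P] : ∀ P → IsSym P → Φ [ Z , P ] ≈ᴹ 0ᴹ) where

      private
        Φ-resp : ∀ ξ η → InΞ₀ ξ → InΞ₀ η → ξ ≈Ξ η → Φ ξ ≈ᴹ Φ η
        Φ-resp = proj₁ Φ-additive
        Φ-++ : ∀ ξ η → InΞ₀ ξ → InΞ₀ η → Φ (ξ ++ η) ≈ᴹ Φ ξ +ᴹ Φ η
        Φ-++ = proj₂ Φ-additive
        []-Ξ₀ : InΞ₀ []
        []-Ξ₀ = [] , refl

      Φ-[] : Φ [] ≈ᴹ 0ᴹ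
      Φ-[] = identityˡ-unique (Φ []) (Φ []) (≈ᴹ-sym (Φ-++ [] [] []-Ξ₀ []-Ξ₀))

      Φ-piece-+ : ∀ m n P → IsSym P → Φ (piece (m + n) Z P) ≈ᴹ Φ (piece m Z P) +ᴹ Φ (piece n Z P)
      Φ-piece-+ m n P P-sym = ≈ᴹ-trans
        (Φ-resp _ _ (piece-Ξ₀ (m + n) Z-sym P-sym) (Ξ₀-++ (piece-Ξ₀ m Z-sym P-sym) (piece-Ξ₀ n Z-sym P-sym))
                (piece-+ m n Z P))
        (Φ-++ _ _ (piece-Ξ₀ m Z-sym P-sym) (piece-Ξ₀ n Z-sym P-sym))

      Φ-piece-0 : ∀ P → IsSym P → Φ (piece 0ℤ Z P) ≈ᴹ 0ᴹ
      Φ-piece-0 P P-sym = ≈ᴹ-trans (Φ-resp _ _ (piece-Ξ₀ 0ℤ Z-sym P-sym) []-Ξ₀ (piece-0 Z P)) Φ-[]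

      -- Induction on the coefficient: +(1 + k) = 1 + (+ k), and n + (−n) = 0.
      Φ-piece⁺ : ∀ k P → IsSym P → Φ (piece (ℤ.+ k) Z P) ≈ᴹ 0ᴹ
      Φ-piece⁺ zero P P-sym = Φ-piece-0 P P-sym
      Φ-piece⁺ (suc k) P P-sym = begin
        Φ (piece (1ℤ + ℤ.+ k) Z P)                       ≈⟨ Φ-piece-+ 1ℤ (ℤ.+ k) P P-sym ⟩
        Φ (piece 1ℤ Z P) +ᴹ Φ (piece (ℤ.+ k) Z P)        ≈⟨ +ᴹ-cong (Φ-[Z,P] P P-sym) (Φ-piece⁺ k P P-sym) ⟩
        0ᴹ +ᴹ 0ᴹ                                         ≈⟨ +ᴹ-identityˡ 0ᴹ ⟩
        0ᴹ                                               ∎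

      Φ-piece : ∀ n P → IsSym P → Φ (piece n Z P) ≈ᴹ 0ᴹ
      Φ-piece (ℤ.+ k) P P-sym = Φ-piece⁺ k P P-sym
      Φ-piece ℤ.-[1+ k ] P P-sym = begin
        Φ (piece n Z P)                                  ≈⟨ +ᴹ-identityʳ _ ⟨
        Φ (piece n Z P) +ᴹ 0ᴹ                            ≈⟨ +ᴹ-congˡ (Φ-piece⁺ (suc k) P P-sym) ⟨
        Φ (piece n Z P) +ᴹ Φ (piece (- n) Z P)           ≈⟨ Φ-piece-+ n (- n) P P-sym ⟨
        Φ (piece (n + - n) Z P)                          ≡⟨ cong (λ i → Φ (piece i Z P)) (ℤP.+-inverseʳ n) ⟩
        Φ (piece 0ℤ Z P)                                 ≈⟨ Φ-piece-0 P P-sym ⟩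
        0ᴹ                                               ∎
        where
        n : ℤ
        n = ℤ.-[1+ k ]

      Φ-pieces : ∀ ξ → InΞ ξ → Φ (pieces Z ξ) ≈ᴹ 0ᴹ
      Φ-pieces [] [] = Φ-[]
      Φ-pieces ((n , P) ∷ ξ) (P-sym ∷ ξ-sym) = begin
        Φ (piece n Z P ++ pieces Z ξ)                    ≈⟨ Φ-++ _ _ (piece-Ξ₀ n Z-sym P-sym) (pieces-Ξ₀ ξ Z-sym ξ-sym) ⟩
        Φ (piece n Z P) +ᴹ Φ (pieces Z ξ)                ≈⟨ +ᴹ-cong (Φ-piece n P P-sym) (Φ-pieces ξ ξ-sym) ⟩
        0ᴹ +ᴹ 0ᴹ                                         ≈⟨ +ᴹ-identityˡ 0ᴹ ⟩
        0ᴹ                                               ∎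

      Φ-Ξ₀ : ∀ ξ → InΞ₀ ξ → Φ ξ ≈ᴹ 0ᴹ
      Φ-Ξ₀ ξ ξ∈@(ξ-sym , deg≡0) =
        ≈ᴹ-trans (Φ-resp _ _ ξ∈ (pieces-Ξ₀ ξ Z-sym ξ-sym) (pieces-≈Ξ Z ξ deg≡0)) (Φ-pieces ξ ξ-sym)

    additive-unique : ∀ Φ Φ′ → IsAdditive Φ → IsAdditive Φ′ → ∀ {Z} → IsSym Z →
                      (∀ P → IsSym P → Φ [ Z , P ] ≈ᴹ Φ′ [ Z , P ]) →
                      ∀ ξ → InΞ₀ ξ → Φ ξ ≈ᴹ Φ′ ξ
    additive-unique Φ Φ′ Φ-add Φ′-add Z-sym agree ξ ξ∈ = x∙y⁻¹≈ε⇒x≈y (Φ ξ) (Φ′ ξ)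
      (Vanishing.Φ-Ξ₀ (λ η → Φ η +ᴹ -ᴹ Φ′ η) (difference-additive Φ Φ′ Φ-add Φ′-add) Z-sym
         (λ P P-sym → x≈y⇒x∙y⁻¹≈ε (agree P P-sym)) ξ ξ∈)


open Generators

module EquivariantExtension {m ℓ : Level} (V : Module ℚ-ring m ℓ) (A : RightAction V) where
  open import Data.Integer using (_+_)
  open import Data.Rational using (0ℚ)
  open Module V
  open RightAction A
  open LinearExtension V
  open import Relation.Binary.Reasoning.Setoid ≈ᴹ-setoid
  open import Algebra.Properties.CommutativeSemigroup
    (CommutativeMonoid.commutativeSemigroup +ᴹ-commutativeMonoid) using (interchange)

  ∣-zero : ∀ g → GL2⁺ g → (0ᴹ ∣ g) ≈ᴹ 0ᴹ
  ∣-zero g g⁺ = begin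
    0ᴹ ∣ g          ≈⟨ ∣-cong g g⁺ (*ₗ-zeroˡ 0ᴹ) ⟨
    (0ℚ *ₗ 0ᴹ) ∣ g  ≈⟨ ∣-*ₗ 0ℚ 0ᴹ g g⁺ ⟩
    0ℚ *ₗ (0ᴹ ∣ g)  ≈⟨ *ₗ-zeroˡ _ ⟩
    0ᴹ              ∎

  extend-•Ξ : ∀ F γ g t → GL2⁺ g → (∀ P → IsSym P → F (γ • P) ≈ᴹ (F P ∣ g) +ᴹ t) →
              ∀ ξ → InΞ ξ → extend F (γ •Ξ ξ) ≈ᴹ (extend F ξ ∣ g) +ᴹ deg ξ ×ᶻ t
  extend-•Ξ F γ g t g⁺ F-equiv [] [] =
    ≈ᴹ-sym (≈ᴹ-trans (+ᴹ-cong (∣-zero g g⁺) (*ₗ-zeroˡ t)) (+ᴹ-identityˡ 0ᴹ))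
  extend-•Ξ F γ g t g⁺ F-equiv ((n , P) ∷ ξ) (P-sym ∷ ξ-sym) = begin
    n ×ᶻ F (γ • P) +ᴹ extend F (γ •Ξ ξ)
      ≈⟨ +ᴹ-cong (*ₗ-congˡ (F-equiv P P-sym)) (extend-•Ξ F γ g t g⁺ F-equiv ξ ξ-sym) ⟩
    n ×ᶻ ((F P ∣ g) +ᴹ t) +ᴹ ((extend F ξ ∣ g) +ᴹ deg ξ ×ᶻ t)
      ≈⟨ +ᴹ-congʳ (*ₗ-distribˡ _ _ _) ⟩
    (n ×ᶻ (F P ∣ g) +ᴹ n ×ᶻ t) +ᴹ ((extend F ξ ∣ g) +ᴹ deg ξ ×ᶻ t)
      ≈⟨ interchange _ _ _ _ ⟩
    (n ×ᶻ (F P ∣ g) +ᴹ (extend F ξ ∣ g)) +ᴹ (n ×ᶻ t +ᴹ deg ξ ×ᶻ t)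
      ≈⟨ +ᴹ-cong (+ᴹ-congʳ (∣-*ₗ _ (F P) g g⁺)) (×ᶻ-distribʳ n (deg ξ) t) ⟨
    (((n ×ᶻ F P) ∣ g) +ᴹ (extend F ξ ∣ g)) +ᴹ (n + deg ξ) ×ᶻ t
      ≈⟨ +ᴹ-congʳ (∣-+ _ _ g g⁺) ⟨
    ((n ×ᶻ F P +ᴹ extend F ξ) ∣ g) +ᴹ (n + deg ξ) ×ᶻ t
      ∎

module Existence {m ℓ : Level} (V : Module ℚ-ring m ℓ) (A : RightAction V)
  (H : Subgroup) (D : SysRep H) (c : M2 → Module.Carrierᴹ V)
  (cocycle : IsCocycle V A H c)
  (vanishes : ∀ Z γ → Z ∈D D → γ ∈H H → γ • Z ≡ Z → Module._≈ᴹ_ V (c γ) (Module.0ᴹ V)) where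

  open import Data.Integer using (0ℤ; 1ℤ; -_)
  open import Data.Rational using (0ℚ)
  import Algebra.Properties.AbelianGroup as AbelianGroupProperties
  open Module V
  open RightAction A
  open Subgroup H
  open SysRep D
  open LinearExtension V
  open EquivariantExtension V A
  open AbelianGroupProperties +ᴹ-abelianGroup using (identityˡ-unique)
  open import Relation.Binary.Reasoning.Setoid ≈ᴹ-setoid

  det≢0 : ∀ {g} → mem g → det g ≢ 0ℚ
  det≢0 {g} g∈H = GL2⁺⇒det≢0 g (⊆GL2⁺ g∈H)

  -- c(1) = c(1·1) = c(1)|1 + c(1) = 2 c(1).
  c-1M : c 1M ≈ᴹ 0ᴹ
  c-1M = identityˡ-unique (c 1M) (c 1M) (begin
    c 1M +ᴹ c 1M          ≈⟨ +ᴹ-congʳ (∣-id (c 1M)) ⟨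
    (c 1M ∣ 1M) +ᴹ c 1M   ≈⟨ cocycle 1M 1M 1∈ 1∈ ⟨
    c (1M *M 1M)          ≡⟨ cong c (*M-identityʳ 1M) ⟩
    c 1M                  ∎)

  -- If h, h′ ∈ H both carry P into 𝒟(H), then h′ h⁻¹ stabilises an element of
  -- 𝒟(H), so c vanishes on it and the cocycle relation gives c h′ = c h.
  c-transporter : ∀ {P h h′ Z Z′} → mem h → mem h′ → memD Z → memD Z′ →
                  h • P ≡ Z → h′ • P ≡ Z′ → c h′ ≈ᴹ c h
  c-transporter {P} {h} {h′} {Z} {Z′} h∈H h′∈H Z∈D Z′∈D hP≡Z h′P≡Z′ = begin
    c h′                ≡⟨ cong c h′≡kh ⟩
    c (k *M h)          ≈⟨ cocycle k h k∈H h∈H ⟩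
    (c k ∣ h) +ᴹ c h    ≈⟨ +ᴹ-congʳ (∣-cong h (⊆GL2⁺ h∈H) ck≈0) ⟩
    (0ᴹ ∣ h) +ᴹ c h     ≈⟨ +ᴹ-congʳ (∣-zero h (⊆GL2⁺ h∈H)) ⟩
    0ᴹ +ᴹ c h           ≈⟨ +ᴹ-identityˡ (c h) ⟩
    c h                 ∎
    where
    k : M2
    k = h′ *M inv h
    k∈H : mem k
    k∈H = *∈ h′∈H (inv∈ h∈H)
    kZ≡Z′ : k • Z ≡ Z′
    kZ≡Z′ = trans (•-*M h′ (inv h) Z (det≢0 (inv∈ h∈H)))
              (trans (cong (λ X → h′ • (inv h • X)) (sym hP≡Z))
                (trans (cong (h′ •_) (•-undo (inv h) h P (det≢0 h∈H) (inv-*ˡ h (det≢0 h∈H)))) h′P≡Z′))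
    ck≈0 : c k ≈ᴹ 0ᴹ
    ck≈0 = vanishes Z k Z∈D k∈H (trans kZ≡Z′ (sym (distinct k Z∈D Z′∈D k∈H kZ≡Z′)))
    h′≡kh : h′ ≡ k *M h
    h′≡kh = sym (trans (*M-assoc h′ (inv h) h)
                    (trans (cong (h′ *M_) (inv-*ˡ h (det≢0 h∈H))) (*M-identityʳ h′)))

  F : Sym → Carrierᴹ
  F (r , s) with r ≟ℙ s
  ... | yes _  = 0ᴹ
  ... | no r≢s = c (proj₁ (covers (r , s) r≢s))

  -- By c-transporter, any other h ∈ H carrying P into 𝒟(H) gives the same value.
  F-spec : ∀ P → IsSym P → ∀ {h Z} → mem h → memD Z → h • P ≡ Z → F P ≈ᴹ c h
  F-spec (r , s) r≢s h∈H Z∈D hP≡Z with r ≟ℙ s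
  ... | yes r≡s = ⊥-elim (r≢s r≡s)
  ... | no r≢s′ with covers (r , s) r≢s′
  ...   | h′ , h′∈H , Z′ , Z′∈D , h′P≡Z′ = c-transporter {P = r , s} h∈H h′∈H Z∈D Z′∈D hP≡Z h′P≡Z′

  -- F (γ P) = F P | γ⁻¹ + c(γ⁻¹): if h carries P into 𝒟(H), then h γ⁻¹ carries γ P.
  F-equiv : ∀ γ P → mem γ → IsSym P → F (γ • P) ≈ᴹ (F P ∣ inv γ) +ᴹ c (inv γ)
  F-equiv γ P γ∈H P-sym with covers P P-sym
  ... | h , h∈H , Z , Z∈D , hP≡Z = begin
    F (γ • P)                   ≈⟨ F-spec (γ • P) (•-IsSym γ P (det≢0 γ∈H) P-sym) (*∈ h∈H γ⁻¹∈H) Z∈D hγ⁻¹γP≡Z ⟩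
    c (h *M inv γ)              ≈⟨ cocycle h (inv γ) h∈H γ⁻¹∈H ⟩
    (c h ∣ inv γ) +ᴹ c (inv γ)  ≈⟨ +ᴹ-congʳ (∣-cong (inv γ) (⊆GL2⁺ γ⁻¹∈H) (F-spec P P-sym h∈H Z∈D hP≡Z)) ⟨
    (F P ∣ inv γ) +ᴹ c (inv γ)  ∎
    where
    γ⁻¹∈H : mem (inv γ)
    γ⁻¹∈H = inv∈ γ∈H
    hγ⁻¹γP≡Z : (h *M inv γ) • (γ • P) ≡ Z
    hγ⁻¹γP≡Z = trans (•-*M h (inv γ) (γ • P) (det≢0 γ⁻¹∈H))
                 (trans (cong (h •_) (•-undo (inv γ) γ P (det≢0 γ∈H) (inv-*ˡ γ (det≢0 γ∈H)))) hP≡Z)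

  Ψ : FS → Carrierᴹ
  Ψ = extend F

  -- Ψ respects Ξ and is additive by construction; equivariance holds on Ξ₀ since
  -- the degree term vanishes there.
  Ψ-hom : IsHomH V A H Ψ
  Ψ-hom = (λ ξ η _ _ → extend-≈Ξ F ξ η)
        , (λ ξ η _ _ → extend-++ F ξ η)
        , equivariant
    where
    equivariant : ∀ γ ξ → mem γ → InΞ₀ ξ → Ψ (γ •Ξ ξ) ≈ᴹ (Ψ ξ ∣ inv γ)
    equivariant γ ξ γ∈H (ξ-sym , deg≡0) = begin
      Ψ (γ •Ξ ξ)                                ≈⟨ extend-•Ξ F γ (inv γ) (c (inv γ)) (⊆GL2⁺ (inv∈ γ∈H))
                                                               (λ P → F-equiv γ P γ∈H) ξ ξ-sym ⟩
      (Ψ ξ ∣ inv γ) +ᴹ deg ξ ×ᶻ c (inv γ)       ≡⟨ cong (λ n → (Ψ ξ ∣ inv γ) +ᴹ n ×ᶻ c (inv γ)) deg≡0 ⟩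
      (Ψ ξ ∣ inv γ) +ᴹ 0ℤ ×ᶻ c (inv γ)          ≈⟨ +ᴹ-congˡ (*ₗ-zeroˡ (c (inv γ))) ⟩
      (Ψ ξ ∣ inv γ) +ᴹ 0ᴹ                       ≈⟨ +ᴹ-identityʳ _ ⟩
      Ψ ξ ∣ inv γ                               ∎

  -- Ψ [Z , γ⁻¹ Z] = F (γ⁻¹ Z) − F Z = c γ − c 1.
  Ψ-value : ∀ γ Z → mem γ → memD Z → Ψ [ Z , inv γ • Z ] ≈ᴹ c γ
  Ψ-value γ Z γ∈H Z∈D = begin
    1ℤ ×ᶻ F (inv γ • Z) +ᴹ ((- 1ℤ) ×ᶻ F Z +ᴹ 0ᴹ)
      ≈⟨ +ᴹ-cong (*ₗ-identityˡ _) (+ᴹ-identityʳ _) ⟩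
    F (inv γ • Z) +ᴹ (- 1ℤ) ×ᶻ F Z
      ≈⟨ +ᴹ-cong (F-spec (inv γ • Z) (•-IsSym (inv γ) Z (det≢0 γ⁻¹∈H) Z-sym) γ∈H Z∈D γγ⁻¹Z≡Z)
                 (*ₗ-congˡ (≈ᴹ-trans (F-spec Z Z-sym 1∈ Z∈D (•-1M Z)) c-1M)) ⟩
    c γ +ᴹ (- 1ℤ) ×ᶻ 0ᴹ
      ≈⟨ +ᴹ-congˡ (*ₗ-zeroʳ _) ⟩
    c γ +ᴹ 0ᴹ
      ≈⟨ +ᴹ-identityʳ (c γ) ⟩
    c γ ∎
    where
    γ⁻¹∈H : mem (inv γ)
    γ⁻¹∈H = inv∈ γ∈H
    Z-sym : IsSym Z
    Z-sym = D⊆𝒫 Z∈D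
    γγ⁻¹Z≡Z : γ • (inv γ • Z) ≡ Z
    γγ⁻¹Z≡Z = •-undo γ (inv γ) Z (det≢0 γ⁻¹∈H) (inv-*ʳ γ (det≢0 γ∈H))


module Uniqueness {m ℓ : Level} (V : Module ℚ-ring m ℓ) (A : RightAction V)
  (H : Subgroup) (D : SysRep H) (c : M2 → Module.Carrierᴹ V) (transitive : Transitive H) where
  open import Data.Rational using (0ℚ)
  open Module V
  open Subgroup H
  open SysRep D

  HasValues : (FS → Carrierᴹ) → Set ℓ
  HasValues Ψ = ∀ γ Z → γ ∈H H → Z ∈D D → Ψ [ Z , inv γ • Z ] ≈ᴹ c γ

  hom⇒additive : ∀ {Ψ} → IsHomH V A H Ψ → IsAdditive V Ψ
  hom⇒additive (Ψ-resp , Ψ-++ , _) = Ψ-resp , Ψ-++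

  unique : ∀ Ψ Ψ′ → IsHomH V A H Ψ → HasValues Ψ → IsHomH V A H Ψ′ → HasValues Ψ′ →
           ∀ ξ → InΞ₀ ξ → Ψ ξ ≈ᴹ Ψ′ ξ
  unique Ψ Ψ′ Ψ-hom Ψ-val Ψ′-hom Ψ′-val =
    additive-unique V Ψ Ψ′ (hom⇒additive Ψ-hom) (hom⇒additive Ψ′-hom) (D⊆𝒫 Z∈D) agree
    where
    -- any element of 𝒟(H) serves as the base point, e.g. the representative of π_∞(0)
    Z : Sym
    Z = proj₁ (proj₂ (proj₂ (covers (∞ , fin 0ℚ) (λ ()))))
    Z∈D : memD Z
    Z∈D = proj₁ (proj₂ (proj₂ (proj₂ (covers (∞ , fin 0ℚ) (λ ())))))
    agree : ∀ P → IsSym P → Ψ [ Z , P ] ≈ᴹ Ψ′ [ Z , P ]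
    agree P P-sym with transitive P Z P-sym (D⊆𝒫 Z∈D)
    ... | h , h∈H , hP≡Z = subst (λ X → Ψ [ Z , X ] ≈ᴹ Ψ′ [ Z , X ]) h⁻¹Z≡P
                                 (≈ᴹ-trans (Ψ-val h Z h∈H Z∈D) (≈ᴹ-sym (Ψ′-val h Z h∈H Z∈D)))
      where
      det≢0 : det h ≢ 0ℚ
      det≢0 = GL2⁺⇒det≢0 h (⊆GL2⁺ h∈H)
      h⁻¹Z≡P : inv h • Z ≡ P
      h⁻¹Z≡P = trans (cong (inv h •_) (sym hP≡Z)) (•-undo (inv h) h P det≢0 (inv-*ˡ h det≢0))

mainTheorem4 : {m ℓ : Level} (V : Module ℚ-ring m ℓ) (A : RightAction V)
    (H : Subgroup) (D : SysRep H) (c : M2 → Module.Carrierᴹ V) →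
    IsCocycle V A H c →
    (∀ Z γ → Z ∈D D → γ ∈H H → γ • Z ≡ Z → Module._≈ᴹ_ V (c γ) (Module.0ᴹ V)) →
    (∃[ Ψ ] (IsHomH V A H Ψ ×
      (∀ γ Z → γ ∈H H → Z ∈D D → Module._≈ᴹ_ V (Ψ [ Z , inv γ • Z ]) (c γ))))
    × (Transitive H → ∀ Ψ Ψ' →
        IsHomH V A H Ψ → (∀ γ Z → γ ∈H H → Z ∈D D → Module._≈ᴹ_ V (Ψ [ Z , inv γ • Z ]) (c γ)) →
        IsHomH V A H Ψ' → (∀ γ Z → γ ∈H H → Z ∈D D → Module._≈ᴹ_ V (Ψ' [ Z , inv γ • Z ]) (c γ)) →
        ∀ ξ → InΞ₀ ξ → Module._≈ᴹ_ V (Ψ ξ) (Ψ' ξ))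
mainTheorem4 V A H D c cocycle vanishes =
  (Ψ , Ψ-hom , Ψ-value) , λ transitive → Uniqueness.unique V A H D c transitive
  where open Existence V A H D c cocycle vanishes
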